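{- Let $\mathcal{P}^j_n=\{P^j_1,\ldots,P^j_n\}$, $j=1,2$, be two point arrangements in $\mathbb{R}^2$, and for $j=1,2$ and $1\leq i\leq n$ let $\sigma^j_i$ be the line cycle at $P^j_i$ for the arrangement $\mathcal{P}^j_n$. Then a bijection $\delta:\mathcal{P}^1_n\to\mathcal{P}^2_n$ is an orientation preserving or an orientation reversing isomorphism if and only if there exists a permutation $\pi\in S_n$ such that $\delta(P^1_i)=P^2_{\pi(i)}$ for all $i$, and either $\sigma^2_{\pi(i)}=\pi\sigma^1_i\pi^{ -1}$ for all $1\leq i\leq n$, or $(\sigma^2_{\pi(i)})^{ -1}=\pi\sigma^1_i\pi^{ -1}$ for all $1\leq i\leq n$.
   Context: A point arrangement is a finite set $\{P_1,\ldots,P_n\}\subset\mathbb{R}^2$ with no three points collinear. A bijection $\delta:\mathcal{P}^1_n\to\mathcal{P}^2_n$ between point arrangements is an isomorphism if for all $A,B,C,D\in\mathcal{P}^1_n$, $D$ lies in the interior of triangle $ABC$ iff $\delta(D)$ lies in the interior of triangle $\delta(A)\delta(B)\delta(C)$. An isomorphism is orientation preserving if for all $A,B,C$ the orientation $A\to B\to C\to A$ of $\Delta ABC$ agrees with the orientation $\delta(A)\to\delta(B)\to\delta(C)\to\delta(A)$, and orientation reversing if these orientations disagree for all $A,B,C$. The line cycle at $P_i$ is the cyclic permutation $\sigma_i$ of $\{1,\ldots,n\}\setminus\{i\}$ recording the cyclic order in which the lines $P_iP_j$ ($j\ne i$) are met when a line through $P_i$ is rotated anticlockwise about $P_i$ (i.e.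 $\sigma_i(j)=k$ if line $P_iP_k$ is the next line met after line $P_iP_j$). -}

module Defs where

open import Level using (0ℓ)
open import Data.Nat using (ℕ)
open import Data.Fin using (Fin)
open import Data.Fin.Permutation using (Permutation′; _⟨$⟩ʳ_; _⟨$⟩ˡ_)
open import Data.Product using (Σ; _×_; _,_)
open import Data.Sum using (_⊎_)
open import Relation.Nullary using (¬_)
open import Relation.Binary.PropositionalEquality using (_≡_; _≢_)
open import Relation.Binary.Core using (Rel)
open import Relation.Binary.Structures using (IsStrictTotalOrder)
open import Algebra.Structures using (IsCommutativeRing)
open import Function.Bundles using (_⇔_)

record OrderedField : Set₁ where
  infixl 6 _+_
  infixl 7 _*_
  infix 4 _<_
  field
    Carrier            : Set
    _+_ _*_            : Carrier → Carrier → Carrier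
    -_                 : Carrier → Carrier
    0# 1#              : Carrier
    isCommutativeRing  : IsCommutativeRing _≡_ _+_ _*_ -_ 0# 1#
    _<_                : Rel Carrier 0ℓ
    isStrictTotalOrder : IsStrictTotalOrder _≡_ _<_
    0<1                : 0# < 1#
    +-monoˡ-<          : ∀ {x y} z → x < y → x + z < y + z
    *-pos              : ∀ {x y} → 0# < x → 0# < y → 0# < x * y
    inverse            : ∀ x → x ≢ 0# → Σ Carrier (λ y → x * y ≡ 1#)

  infixl 6 _-_
  _-_ : Carrier → Carrier → Carrier
  x - y = x + (- y)

module Geometry (F : OrderedField) where
  open OrderedField F

  Point : Set
  Point = Carrier × Carrier

  x-coord y-coord : Point → Carrier
  x-coord (x , _) = x
  y-coord (_ , y) = y

  cross : Point → Point → Point → Carrier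
  cross A B C = (x-coord B - x-coord A) * (y-coord C - y-coord A)
              - (y-coord B - y-coord A) * (x-coord C - x-coord A)

  -- A → B → C → A is anticlockwise iff 0 < orient A B C
  orient : Point → Point → Point → Carrier
  orient = cross

  Inside : Point → Point → Point → Point → Set
  Inside D A B C =
      (0# < orient A B D × 0# < orient B C D × 0# < orient C A D)
    ⊎ (orient A B D < 0# × orient B C D < 0# × orient C A D < 0#)

  Distinct3 : ∀ {n} → Fin n → Fin n → Fin n → Set
  Distinct3 a b c = a ≢ b × b ≢ c × a ≢ c

  record Arrangement (n : ℕ) : Set where
    field
      pt        : Fin n → Point
      injective : ∀ a b → pt a ≡ pt b → a ≡ b
      noThreeCollinear : ∀ a b c → Distinct3 a b c →
                         orient (pt a) (pt b) (pt c) ≢ 0#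
  open Arrangement public

  -- The bijection δ between the point sets, described on indices:
  -- δ (P¹ a) = P² (δ a).
  IsIsomorphism : ∀ {n} → Arrangement n → Arrangement n → Permutation′ n → Set
  IsIsomorphism P Q δ = ∀ a b c d →
    Inside (pt P d) (pt P a) (pt P b) (pt P c)
      ⇔ Inside (pt Q (δ ⟨$⟩ʳ d)) (pt Q (δ ⟨$⟩ʳ a)) (pt Q (δ ⟨$⟩ʳ b)) (pt Q (δ ⟨$⟩ʳ c))

  OrientationPreserving : ∀ {n} → Arrangement n → Arrangement n → Permutation′ n → Set
  OrientationPreserving P Q δ = ∀ a b c → Distinct3 a b c →
    (0# < orient (pt P a) (pt P b) (pt P c))
      ⇔ (0# < orient (pt Q (δ ⟨$⟩ʳ a)) (pt Q (δ ⟨$⟩ʳ b)) (pt Q (δ ⟨$⟩ʳ c)))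

  OrientationReversing : ∀ {n} → Arrangement n → Arrangement n → Permutation′ n → Set
  OrientationReversing P Q δ = ∀ a b c → Distinct3 a b c →
    (0# < orient (pt P a) (pt P b) (pt P c))
      ⇔ (orient (pt Q (δ ⟨$⟩ʳ a)) (pt Q (δ ⟨$⟩ʳ b)) (pt Q (δ ⟨$⟩ʳ c)) < 0#)

  -- At P i, put c j k = cross (P i) (P j) (P k).  Rotating
  -- a line anticlockwise about P i starting at line P i P j, the line
  -- P i P l is met strictly before line P i P k (k ≠ j) iff
  -- 0 < c j l * c j k * c l k  (orient the direction vectors into the
  -- open half-plane anticlockwise of P j - P i and compare).  Line P i P j
  -- itself is met again only after a full half-turn.
  MetBefore : {n : ℕ} → Arrangement n → (i j l k : Fin n) → Set
  MetBefore {n} P i j l k =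
      (l ≢ j × k ≡ j)
    ⊎ (l ≢ j × k ≢ j × l ≢ k ×
       0# < c j l * c j k * c l k)
    where
      c : Fin n → Fin n → Carrier
      c a b = cross (pt P i) (pt P a) (pt P b)

  IsNextLine : ∀ {n} → Arrangement n → (i j k : Fin n) → Set
  IsNextLine P i j k = k ≢ i × (∀ l → l ≢ i → ¬ MetBefore P i j l k)

  -- σ is the line cycle at P i: a permutation of {1..n} ∖ {i},
  -- represented as a permutation of Fin n fixing i.
  IsLineCycle : ∀ {n} → Arrangement n → Fin n → Permutation′ n → Set
  IsLineCycle P i σ =
    (σ ⟨$⟩ʳ i ≡ i) × (∀ j → j ≢ i → IsNextLine P i j (σ ⟨$⟩ʳ j))

-- Orientations are compared through their signs in {neg, zer, pos}, a
-- commutative monoid whose nonzero elements form the group {±1}.  At a point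
-- P i of an arrangement, lineSign i a b c = χ i a b ⊗ χ i a c ⊗ χ i b c
-- (χ = orientation sign) tells whether a line rotating anticlockwise about
-- P i meets line P i P b between lines P i P a and P i P c.  By the Plücker
-- relation this "Between i" is a cyclic order on the other indices, and the
-- line cycle at P i is exactly its successor function.
--
-- (⇒) If δ multiplies every orientation sign by e = ±, it multiplies every
-- line sign by e ⊗ e ⊗ e = e, so it maps line orders to line orders (e = pos)
-- or to their reverses (e = neg); successors being unique, δ conjugates σ¹ i
-- to σ² (δ i) or to its inverse.
-- (⇐) A cyclic order is determined by its successor function (by walking
-- along successors, a well-founded process on the finite set Fin n).  So if
-- π conjugates the line cycles, π multiplies every line sign by one e = ±.
-- The discrepancy D a b c = χ² (π a) (π b) (π c) ⊗ χ¹ a b c is then symmetric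
-- with D i j l ⊗ D i j k ⊗ D i l k = e, which forces D to be constant on
-- distinct triples: π, hence δ, multiplies all orientations by one sign.
module Submission where

open import Defs
open import Level using (0ℓ)
open import Data.Nat using (ℕ)
open import Data.Fin using (Fin; _≟_)
open import Data.Fin.Properties using (any?)
open import Data.Fin.Permutation using (Permutation′; _⟨$⟩ʳ_; _⟨$⟩ˡ_; inverseˡ; inverseʳ)
open import Data.Product using (Σ; _×_; _,_; proj₁; proj₂)
open import Data.Sum using (_⊎_; inj₁; inj₂; swap)
open import Data.Empty using (⊥-elim)
open import Data.Maybe using (nothing)
open import Algebra.Bundles using (CommutativeMonoid; CommutativeRing)
open import Relation.Binary.Structures using (IsStrictPartialOrder; IsStrictTotalOrder)
open import Relation.Nullary using (¬_; ¬?; Dec; yes; no)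
open import Relation.Nullary.Decidable using (_×-dec_)
open import Relation.Binary.Definitions using (tri<; tri≈; tri>)
open import Relation.Binary.PropositionalEquality

open import Induction.WellFounded using (Acc; acc)
open import Data.Fin.Induction using (spo-wellFounded)

open import Algebra.Structures.Biased using (isCommutativeMonoidˡ)
open import Function.Bundles using (_⇔_; mk⇔; Equivalence)
import Function.Properties.Equivalence as ⇔
open import Data.Product.Function.NonDependent.Propositional using (_×-⇔_)
open import Data.Sum.Function.Propositional using (_⊎-⇔_)

data Sign : Set where
  neg zer pos : Sign

infixl 7 _⊗_
_⊗_ : Sign → Sign → Sign
pos ⊗ s = s
zer ⊗ s = zer
neg ⊗ neg = pos
neg ⊗ zer = zer
neg ⊗ pos = neg

⊗-comm : ∀ s t → s ⊗ t ≡ t ⊗ s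
⊗-comm neg neg = refl
⊗-comm neg zer = refl
⊗-comm neg pos = refl
⊗-comm zer neg = refl
⊗-comm zer zer = refl
⊗-comm zer pos = refl
⊗-comm pos neg = refl
⊗-comm pos zer = refl
⊗-comm pos pos = refl

⊗-assoc : ∀ s t u → (s ⊗ t) ⊗ u ≡ s ⊗ (t ⊗ u)
⊗-assoc pos t u = refl
⊗-assoc zer t u = refl
⊗-assoc neg pos u = refl
⊗-assoc neg zer u = refl
⊗-assoc neg neg neg = refl
⊗-assoc neg neg zer = refl
⊗-assoc neg neg pos = refl

⊗-commutativeMonoid : CommutativeMonoid 0ℓ 0ℓ
⊗-commutativeMonoid = record
  { isCommutativeMonoid = isCommutativeMonoidˡ record
    { isSemigroup = record
      { isMagma = record { isEquivalence = isEquivalence ; ∙-cong = cong₂ _⊗_ }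
      ; assoc = ⊗-assoc }
    ; identityˡ = λ _ → refl
    ; comm = ⊗-comm } }

open import Algebra.Solver.CommutativeMonoid ⊗-commutativeMonoid
  using (_⊜_; _⊕_) renaming (solve to ⊗-solve)

pos≢zer : pos ≢ zer
pos≢zer ()

neg≢zer : neg ≢ zer
neg≢zer ()

_≟ₛ_ : (s t : Sign) → Dec (s ≡ t)
neg ≟ₛ neg = yes refl
zer ≟ₛ zer = yes refl
pos ≟ₛ pos = yes refl
neg ≟ₛ zer = no λ ()
neg ≟ₛ pos = no λ ()
zer ≟ₛ neg = no λ ()
zer ≟ₛ pos = no λ ()
pos ≟ₛ neg = no λ ()
pos ≟ₛ zer = no λ ()

⊗-self : ∀ {s} → s ≢ zer → s ⊗ s ≡ pos
⊗-self {neg} _ = refl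
⊗-self {zer} s≢0 = ⊥-elim (s≢0 refl)
⊗-self {pos} _ = refl

⊗-involutiveʳ : ∀ s {u} → u ≢ zer → s ⊗ u ⊗ u ≡ s
⊗-involutiveʳ s {u} u≢0 = trans (⊗-assoc s u u) (trans (cong (s ⊗_) (⊗-self u≢0)) (⊗-comm s pos))

⊗-cancelʳ : ∀ {s t u} → u ≢ zer → s ⊗ u ≡ t ⊗ u → s ≡ t
⊗-cancelʳ {s} {t} {u} u≢0 e =
  trans (sym (⊗-involutiveʳ s u≢0)) (trans (cong (_⊗ u) e) (⊗-involutiveʳ t u≢0))

⊗-cancelˡ : ∀ {s t u} → u ≢ zer → u ⊗ s ≡ u ⊗ t → s ≡ t
⊗-cancelˡ {s} {t} {u} u≢0 e = ⊗-cancelʳ u≢0 (trans (⊗-comm s u) (trans e (⊗-comm u t)))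

⊗≡pos⇒≡ : ∀ {s t} → t ≢ zer → s ⊗ t ≡ pos → s ≡ t
⊗≡pos⇒≡ {s} {t} t≢0 st≡+ = ⊗-cancelʳ t≢0 (trans st≡+ (sym (⊗-self t≢0)))

⊗-cube : ∀ s → s ⊗ s ⊗ s ≡ s
⊗-cube neg = refl
⊗-cube zer = refl
⊗-cube pos = refl

⊗-≢zer : ∀ {s t} → s ≢ zer → t ≢ zer → s ⊗ t ≢ zer
⊗-≢zer {pos} _ t≢0 = t≢0
⊗-≢zer {zer} s≢0 _ = ⊥-elim (s≢0 refl)
⊗-≢zer {neg} {neg} _ _ ()
⊗-≢zer {neg} {zer} _ t≢0 _ = t≢0 refl
⊗-≢zer {neg} {pos} _ _ ()

⊗-≢zerˡ : ∀ {s t} → s ⊗ t ≢ zer → s ≢ zer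
⊗-≢zerˡ st≢0 refl = st≢0 refl

⊗-≢zerʳ : ∀ {s t} → s ⊗ t ≢ zer → t ≢ zer
⊗-≢zerʳ {s} st≢0 refl = st≢0 (⊗-comm s zer)

-- A sign equal to its own negative is zero (the sign of an alternating form
-- with two equal arguments).
self-negative⇒zer : ∀ {s} → s ≡ neg ⊗ s → s ≡ zer
self-negative⇒zer {zer} _ = refl
self-negative⇒zer {neg} ()
self-negative⇒zer {pos} ()

≡-byPositivity : ∀ {s t} → s ≢ zer → t ≢ zer → (s ≡ pos → t ≡ pos) → (t ≡ pos → s ≡ pos) → s ≡ t
≡-byPositivity {pos} {pos} _ _ _ _ = refl
≡-byPositivity {neg} {neg} _ _ _ _ = refl
≡-byPositivity {pos} {neg} _ _ s⇒t _ with s⇒t refl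
... | ()
≡-byPositivity {neg} {pos} _ _ _ t⇒s with t⇒s refl
... | ()
≡-byPositivity {zer} s≢0 _ _ _ = ⊥-elim (s≢0 refl)
≡-byPositivity {_} {zer} _ t≢0 _ _ = ⊥-elim (t≢0 refl)

≡-neg-byPositivity : ∀ {s t} → s ≢ zer → t ≢ zer → (s ≡ pos → t ≡ neg) → (t ≡ neg → s ≡ pos) → t ≡ neg ⊗ s
≡-neg-byPositivity {pos} {neg} _ _ _ _ = refl
≡-neg-byPositivity {neg} {pos} _ _ _ _ = refl
≡-neg-byPositivity {pos} {pos} _ _ s⇒t _ with s⇒t refl
... | ()
≡-neg-byPositivity {neg} {neg} _ _ _ t⇒s with t⇒s refl
... | ()
≡-neg-byPositivity {zer} s≢0 _ _ _ = ⊥-elim (s≢0 refl)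
≡-neg-byPositivity {_} {zer} _ t≢0 _ _ = ⊥-elim (t≢0 refl)

factors-≢zer : ∀ s t u → s ⊗ t ⊗ u ≡ pos → s ≢ zer × t ≢ zer × u ≢ zer
factors-≢zer s t u stu≡+ =
  ⊗-≢zerˡ st≢0 , ⊗-≢zerʳ {s} st≢0 , ⊗-≢zerʳ {s ⊗ t} stu≢0
  where
    stu≢0 : s ⊗ t ⊗ u ≢ zer
    stu≢0 e = pos≢zer (trans (sym stu≡+) e)
    st≢0 : s ⊗ t ≢ zer
    st≢0 = ⊗-≢zerˡ stu≢0

-- Sign bookkeeping for the transitivity of line orders.  Writing xy for the
-- sign of det(w_x, w_y) of four plane vectors, the hypotheses say that b lies
-- between a and c, and c between a and d.  Then the two terms of the Plücker
-- relation det(a,c)det(b,d) = det(a,b)det(c,d) + det(a,d)det(b,c) have the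
-- same sign ...
plücker-terms-agree : ∀ {ab ac ad bc cd} → ab ⊗ ac ⊗ bc ≡ pos → ac ⊗ ad ⊗ cd ≡ pos →
                      ad ⊗ bc ≡ ab ⊗ cd
plücker-terms-agree {ab} {ac} {ad} {bc} {cd} abc acd with factors-≢zer ab ac bc abc | factors-≢zer ac ad cd acd
... | ab≢0 , ac≢0 , _ | _ , _ , cd≢0 = ⊗≡pos⇒≡ {ad ⊗ bc} (⊗-≢zer ab≢0 cd≢0) (begin
  ad ⊗ bc ⊗ (ab ⊗ cd)                    ≡⟨ sym (⊗-involutiveʳ _ ac≢0) ⟩
  ad ⊗ bc ⊗ (ab ⊗ cd) ⊗ ac ⊗ ac          ≡⟨ ⊗-solve 5 (λ ab ac ad bc cd →
                                               (((ad ⊕ bc) ⊕ (ab ⊕ cd)) ⊕ ac) ⊕ ac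
                                               ⊜ ((ab ⊕ ac) ⊕ bc) ⊕ ((ac ⊕ ad) ⊕ cd))
                                               refl ab ac ad bc cd ⟩
  (ab ⊗ ac ⊗ bc) ⊗ (ac ⊗ ad ⊗ cd)        ≡⟨ cong₂ _⊗_ abc acd ⟩
  pos                                     ∎)
  where open ≡-Reasoning

-- ... so the left-hand side has the sign ab·cd as well, which says that b
-- lies between a and d.
line-transitivity-sign : ∀ {ab ac ad bc bd cd} → ab ⊗ ac ⊗ bc ≡ pos → ac ⊗ ad ⊗ cd ≡ pos →
                         ac ⊗ bd ≡ ab ⊗ cd → ab ⊗ ad ⊗ bd ≡ pos
line-transitivity-sign {ab} {ac} {ad} {bc} {bd} {cd} abc acd plücker-sign
  with factors-≢zer ab ac bc abc
... | ab≢0 , ac≢0 , _ = begin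
  ab ⊗ ad ⊗ bd                         ≡⟨ sym (⊗-involutiveʳ _ ac≢0) ⟩
  ab ⊗ ad ⊗ bd ⊗ ac ⊗ ac               ≡⟨ ⊗-solve 4 (λ ab ac ad bd →
                                            (((ab ⊕ ad) ⊕ bd) ⊕ ac) ⊕ ac ⊜ ((ab ⊕ ad) ⊕ ac) ⊕ (ac ⊕ bd))
                                            refl ab ac ad bd ⟩
  ab ⊗ ad ⊗ ac ⊗ (ac ⊗ bd)             ≡⟨ cong (ab ⊗ ad ⊗ ac ⊗_) plücker-sign ⟩
  ab ⊗ ad ⊗ ac ⊗ (ab ⊗ cd)             ≡⟨ ⊗-solve 4 (λ ab ac ad cd →
                                            ((ab ⊕ ad) ⊕ ac) ⊕ (ab ⊕ cd) ⊜ ((((ac ⊕ ad) ⊕ cd) ⊕ ab) ⊕ ab))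
                                            refl ab ac ad cd ⟩
  (ac ⊗ ad ⊗ cd) ⊗ ab ⊗ ab             ≡⟨ ⊗-involutiveʳ _ ab≢0 ⟩
  ac ⊗ ad ⊗ cd                         ≡⟨ acd ⟩
  pos                                  ∎
  where open ≡-Reasoning

Ternary : ℕ → Set₁
Ternary n = Fin n → Fin n → Fin n → Set

-- A strict cyclic order on Fin n ∖ {i}: C a b c reads "going round from a,
-- b is met strictly before c".
record CyclicOrder {n : ℕ} (i : Fin n) (C : Ternary n) : Set where
  field
    rotate     : ∀ {a b c} → C a b c → C b c a
    asym       : ∀ {a b c} → C a b c → ¬ C a c b
    total      : ∀ {a b c} → a ≢ i → b ≢ i → c ≢ i → a ≢ b → b ≢ c → a ≢ c →
                 C a b c ⊎ C a c b
    transitive : ∀ {a b c d} → C a b c → C a c d → C a b d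
    distinct   : ∀ {a b c} → C a b c →
                 (a ≢ i × b ≢ i × c ≢ i) × (a ≢ b × b ≢ c × a ≢ c)

-- k is the successor of j in C: nothing lies strictly between j and k, and
-- k can only be j itself when j is the only element of Fin n ∖ {i}.
record IsSuccessor {n : ℕ} (C : Ternary n) (i j k : Fin n) : Set where
  field
    ≢centre  : k ≢ i
    loop     : k ≡ j → ∀ l → l ≢ i → l ≡ j
    adjacent : ∀ l → ¬ C j l k

module CyclicOrderProperties {n : ℕ} {i : Fin n} {C : Ternary n} (O : CyclicOrder i C) where
  open CyclicOrder O

  between-trans : ∀ {j m y k} → C j m k → C m y k → C j y k
  between-trans h₁ h₂ = rotate (transitive (rotate (rotate h₁)) (rotate (rotate h₂)))

  split : ∀ {x a b c} → C x a b → C x b c → C a b c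
  split {x} {a} {b} {c} h₁ h₂ with distinct (transitive h₁ h₂) | distinct h₁ | distinct h₂
  ... | (_ , a≢i , c≢i) , (_ , a≢c , _) | (_ , _ , b≢i) , (_ , a≢b , _) | _ , (_ , b≢c , _)
    with total a≢i b≢i c≢i a≢b b≢c a≢c
  ... | inj₁ abc = abc
  ... | inj₂ acb = ⊥-elim (asym h₁ (rotate (rotate (transitive (rotate (rotate acb)) (rotate h₂)))))

  successor-first : ∀ {j s k} → IsSuccessor C i j s → j ≢ i → k ≢ i → j ≢ k → s ≢ j → s ≢ k →
                    C j s k
  successor-first {j} {s} {k} succ j≢i k≢i j≢k s≢j s≢k
    with total j≢i (IsSuccessor.≢centre succ) k≢i (λ e → s≢j (sym e)) s≢k j≢k
  ... | inj₁ jsk = jsk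
  ... | inj₂ jks = ⊥-elim (IsSuccessor.adjacent succ k jks)

  successor-unique : ∀ {j k k′} → j ≢ i → IsSuccessor C i j k → IsSuccessor C i j k′ → k ≡ k′
  successor-unique {j} {k} {k′} j≢i s s′ with k ≟ j | k′ ≟ j
  ... | yes k≡j | _ = trans (loop k≡j k ≢centre) (sym (loop k≡j k′ (IsSuccessor.≢centre s′)))
    where open IsSuccessor s
  ... | no _ | yes k′≡j = trans (loop k′≡j k (IsSuccessor.≢centre s)) (sym (loop k′≡j k′ ≢centre))
    where open IsSuccessor s′
  ... | no k≢j | no k′≢j with k ≟ k′
  ...   | yes k≡k′ = k≡k′
  ...   | no k≢k′ with total j≢i (IsSuccessor.≢centre s) (IsSuccessor.≢centre s′)
                        (λ e → k≢j (sym e)) k≢k′ (λ e → k′≢j (sym e))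
  ...     | inj₁ jkk′ = ⊥-elim (IsSuccessor.adjacent s′ k jkk′)
  ...     | inj₂ jk′k = ⊥-elim (IsSuccessor.adjacent s k′ jk′k)

⟨$⟩ʳ-injective : ∀ {n} (δ : Permutation′ n) {a b} → δ ⟨$⟩ʳ a ≡ δ ⟨$⟩ʳ b → a ≡ b
⟨$⟩ʳ-injective δ e = trans (sym (inverseˡ δ)) (trans (cong (δ ⟨$⟩ˡ_) e) (inverseˡ δ))

⟨$⟩ʳ-≢ : ∀ {n} (δ : Permutation′ n) {a b} → a ≢ b → δ ⟨$⟩ʳ a ≢ δ ⟨$⟩ʳ b
⟨$⟩ʳ-≢ δ a≢b e = a≢b (⟨$⟩ʳ-injective δ e)

pullback : ∀ {n} {i : Fin n} {C : Ternary n} (f : Permutation′ n) →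
           CyclicOrder (f ⟨$⟩ʳ i) C → CyclicOrder i (λ a b c → C (f ⟨$⟩ʳ a) (f ⟨$⟩ʳ b) (f ⟨$⟩ʳ c))
pullback f O = record
  { rotate     = rotate
  ; asym       = asym
  ; total      = λ a≢i b≢i c≢i a≢b b≢c a≢c →
                   total (push a≢i) (push b≢i) (push c≢i) (push a≢b) (push b≢c) (push a≢c)
  ; transitive = transitive
  ; distinct   = λ h → let ((a≢i , b≢i , c≢i) , (a≢b , b≢c , a≢c)) = distinct h in
                   (pull a≢i , pull b≢i , pull c≢i) , (pull a≢b , pull b≢c , pull a≢c)
  }
  where
    open CyclicOrder O
    push : ∀ {a b} → a ≢ b → f ⟨$⟩ʳ a ≢ f ⟨$⟩ʳ b
    push = ⟨$⟩ʳ-≢ f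
    pull : ∀ {a b} → f ⟨$⟩ʳ a ≢ f ⟨$⟩ʳ b → a ≢ b
    pull fa≢fb e = fa≢fb (cong (f ⟨$⟩ʳ_) e)

reverse : ∀ {n} {i : Fin n} {C : Ternary n} → CyclicOrder i C → CyclicOrder i (λ a b c → C c b a)
reverse {C = C} O = record
  { rotate     = λ h → rotate (rotate h)
  ; asym       = λ h h′ → asym (rotate h) h′
  ; total      = λ a≢i b≢i c≢i a≢b b≢c a≢c → flip (total a≢i b≢i c≢i a≢b b≢c a≢c)
  ; transitive = λ h₁ h₂ → rotate (transitive (rotate (rotate h₂)) (rotate (rotate h₁)))
  ; distinct   = λ h → let ((c≢i , b≢i , a≢i) , (c≢b , b≢a , c≢a)) = distinct h in
                   (a≢i , b≢i , c≢i) , (≢-sym b≢a , ≢-sym c≢b , ≢-sym c≢a)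
  }
  where
    open CyclicOrder O
    flip : ∀ {a b c} → C a b c ⊎ C a c b → C c b a ⊎ C b c a
    flip (inj₁ abc) = inj₂ (rotate abc)
    flip (inj₂ acb) = inj₁ (rotate acb)

successor-image : ∀ {n} {C¹ C² : Ternary n} (f : Permutation′ n) →
  (∀ {a b c} → C² (f ⟨$⟩ʳ a) (f ⟨$⟩ʳ b) (f ⟨$⟩ʳ c) → C¹ a b c) →
  ∀ {i j k} → IsSuccessor C¹ i j k → IsSuccessor C² (f ⟨$⟩ʳ i) (f ⟨$⟩ʳ j) (f ⟨$⟩ʳ k)
successor-image {C² = C²} f reflect {i} {j} {k} succ = record
  { ≢centre  = λ fk≡fi → ≢centre (⟨$⟩ʳ-injective f fk≡fi)
  ; loop     = λ fk≡fj l l≢fi → trans (sym (inverseʳ f))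
                 (cong (f ⟨$⟩ʳ_) (loop (⟨$⟩ʳ-injective f fk≡fj) (f ⟨$⟩ˡ l)
                   (λ e → l≢fi (trans (sym (inverseʳ f)) (cong (f ⟨$⟩ʳ_) e)))))
  ; adjacent = λ l between → adjacent (f ⟨$⟩ˡ l)
                 (reflect (subst (λ z → C² (f ⟨$⟩ʳ j) z (f ⟨$⟩ʳ k)) (sym (inverseʳ f)) between))
  }
  where open IsSuccessor succ

successor-preimage : ∀ {n} {C : Ternary n} (f : Permutation′ n) → ∀ {i j k} →
  IsSuccessor C (f ⟨$⟩ʳ i) (f ⟨$⟩ʳ j) (f ⟨$⟩ʳ k) →
  IsSuccessor (λ a b c → C (f ⟨$⟩ʳ a) (f ⟨$⟩ʳ b) (f ⟨$⟩ʳ c)) i j k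
successor-preimage f succ = record
  { ≢centre  = λ k≡i → ≢centre (cong (f ⟨$⟩ʳ_) k≡i)
  ; loop     = λ k≡j l l≢i → ⟨$⟩ʳ-injective f
                 (loop (cong (f ⟨$⟩ʳ_) k≡j) (f ⟨$⟩ʳ l) (λ e → l≢i (⟨$⟩ʳ-injective f e)))
  ; adjacent = λ l → adjacent (f ⟨$⟩ʳ l)
  }
  where open IsSuccessor succ

successor-reverse : ∀ {n} {C : Ternary n} {i j k} → j ≢ i →
  IsSuccessor C i j k → IsSuccessor (λ a b c → C c b a) i k j
successor-reverse j≢i succ = record
  { ≢centre  = j≢i
  ; loop     = λ j≡k l l≢i → trans (loop (sym j≡k) l l≢i) j≡k
  ; adjacent = adjacent
  }
  where open IsSuccessor succ

-- If y lies between j and k in C¹, walk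
-- from j along successors towards k; the walk terminates because "lies
-- between _ and k" is a strict partial order on the finite set Fin n.
successor-determines : ∀ {n} {i : Fin n} {C¹ C² : Ternary n} →
  CyclicOrder i C¹ → CyclicOrder i C² → (σ : Fin n → Fin n) →
  (∀ j → j ≢ i → IsSuccessor C¹ i j (σ j)) → (∀ j → j ≢ i → IsSuccessor C² i j (σ j)) →
  ∀ {j y k} → C¹ j y k → C² j y k
successor-determines {n} {C¹ = C¹} {C²} O¹ O² σ succ¹ succ² {j} {y} {k} =
  walk (spo-wellFounded closer-isSPO j) y
  where
    module O¹ = CyclicOrder O¹
    module P¹ = CyclicOrderProperties O¹
    module P² = CyclicOrderProperties O²

    _≺_ : Fin n → Fin n → Set
    m ≺ j = C¹ j m k

    closer-isSPO : IsStrictPartialOrder _≡_ _≺_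
    closer-isSPO = record
      { isEquivalence = isEquivalence
      ; irrefl        = λ { refl h → proj₁ (proj₂ (O¹.distinct h)) refl }
      ; trans         = λ h₁ h₂ → P¹.between-trans h₂ h₁
      ; <-resp-≈      = (λ { refl h → h }) , (λ { refl h → h })
      }

    walk : ∀ {j} → Acc _≺_ j → ∀ y → C¹ j y k → C² j y k
    walk {j} (acc rec) y jyk with O¹.distinct jyk
    ... | (j≢i , y≢i , k≢i) , (j≢y , _ , j≢k) = advance (y ≟ σ j)
      where
        s≢k : σ j ≢ k
        s≢k e = IsSuccessor.adjacent (succ¹ j j≢i) y (subst (C¹ j y) (sym e) jyk)
        s≢j : σ j ≢ j
        s≢j e = j≢y (sym (IsSuccessor.loop (succ¹ j j≢i) e y y≢i))
        jsk¹ : C¹ j (σ j) k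
        jsk¹ = P¹.successor-first (succ¹ j j≢i) j≢i k≢i j≢k s≢j s≢k
        jsk² : C² j (σ j) k
        jsk² = P².successor-first (succ² j j≢i) j≢i k≢i j≢k s≢j s≢k
        advance : Dec (y ≡ σ j) → C² j y k
        advance (yes y≡s) = subst (λ z → C² j z k) (sym y≡s) jsk²
        advance (no y≢s) = P².between-trans jsk² (walk (rec jsk¹) y (P¹.split jsy¹ jyk))
          where
            jsy¹ : C¹ j (σ j) y
            jsy¹ = P¹.successor-first (succ¹ j j≢i) j≢i y≢i j≢y s≢j (λ e → y≢s (sym e))

module PlaneGeometry (F : OrderedField) where
  open OrderedField F
  open Geometry F

  private
    commutativeRing : CommutativeRing 0ℓ 0ℓ
    commutativeRing = record { isCommutativeRing = isCommutativeRing }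
    module R = CommutativeRing commutativeRing
  open import Algebra.Properties.Ring R.ring using (-‿distribˡ-*; -‿distribʳ-*)
  open import Algebra.Properties.AbelianGroup R.+-abelianGroup
    using (⁻¹-∙-comm; ⁻¹-involutive; ⁻¹-anti-homo‿-; ε⁻¹≈ε)
  open import Algebra.Solver.Ring.NaturalCoefficients R.commutativeSemiring (λ _ _ → nothing)
  open IsStrictTotalOrder isStrictTotalOrder using (compare; irrefl; asym) renaming (trans to <-trans)
  open ≡-Reasoning

  -- Arithmetic of differences: each identity below is reduced to an identity
  -- between sums of products, which the semiring solver proves (negated
  -- variables are handed to it as separate atoms).
  neg-mul : ∀ a b → (- a) * (- b) ≡ a * b
  neg-mul a b = begin
    (- a) * (- b) ≡⟨ sym (-‿distribˡ-* a (- b)) ⟩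
    - (a * - b)   ≡⟨ cong -_ (sym (-‿distribʳ-* a b)) ⟩
    - - (a * b)   ≡⟨ ⁻¹-involutive (a * b) ⟩
    a * b         ∎

  sub-add : ∀ a b c d → (a - b) + (c - d) ≡ (a + c) - (b + d)
  sub-add a b c d = begin
    (a + - b) + (c + - d) ≡⟨ solve 4 (λ a nb c nd → (a :+ nb) :+ (c :+ nd) := (a :+ c) :+ (nb :+ nd))
                                    refl a (- b) c (- d) ⟩
    (a + c) + (- b + - d) ≡⟨ cong ((a + c) +_) (⁻¹-∙-comm b d) ⟩
    (a + c) - (b + d)     ∎

  sub-mul : ∀ a b c d → (a - b) * (c - d) ≡ (a * c + b * d) - (a * d + b * c)
  sub-mul a b c d = begin
    (a + - b) * (c + - d)
      ≡⟨ solve 4 (λ a nb c nd → (a :+ nb) :* (c :+ nd) := (a :* c :+ nb :* nd) :+ (a :* nd :+ nb :* c))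
               refl a (- b) c (- d) ⟩
    (a * c + (- b) * (- d)) + (a * (- d) + (- b) * c)
      ≡⟨ cong₂ (λ u v → (a * c + u) + v) (neg-mul b d)
               (cong₂ _+_ (sym (-‿distribʳ-* a d)) (sym (-‿distribˡ-* b c))) ⟩
    (a * c + b * d) + (- (a * d) + - (b * c))
      ≡⟨ cong ((a * c + b * d) +_) (⁻¹-∙-comm (a * d) (b * c)) ⟩
    (a * c + b * d) - (a * d + b * c) ∎

  sub-cong : ∀ a b c d → a + d ≡ c + b → a - b ≡ c - d
  sub-cong a b c d h = begin
    a + - b                 ≡⟨ sym (R.+-identityʳ _) ⟩
    (a + - b) + 0#          ≡⟨ cong ((a + - b) +_) (sym (R.-‿inverseʳ d)) ⟩
    (a + - b) + (d + - d)   ≡⟨ solve 4 (λ a nb d nd → (a :+ nb) :+ (d :+ nd) := (a :+ d) :+ (nd :+ nb))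
                                     refl a (- b) d (- d) ⟩
    (a + d) + (- d + - b)   ≡⟨ cong (_+ (- d + - b)) h ⟩
    (c + b) + (- d + - b)   ≡⟨ solve 4 (λ c b nd nb → (c :+ b) :+ (nd :+ nb) := (c :+ nd) :+ (b :+ nb))
                                     refl c b (- d) (- b) ⟩
    (c + - d) + (b + - b)   ≡⟨ cong ((c + - d) +_) (R.-‿inverseʳ b) ⟩
    (c + - d) + 0#          ≡⟨ R.+-identityʳ _ ⟩
    c - d                   ∎

  expand : ∀ p q r s t u v w → (p - q) * (r - s) - (t - u) * (v - w)
         ≡ (p * r + q * s + (t * w + u * v)) - (p * s + q * r + (t * v + u * w))
  expand p q r s t u v w = begin
    (p - q) * (r - s) - (t - u) * (v - w)
      ≡⟨ cong₂ _-_ (sub-mul p q r s) (sub-mul t u v w) ⟩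
    ((p * r + q * s) - (p * s + q * r)) - ((t * v + u * w) - (t * w + u * v))
      ≡⟨ cong ((p * r + q * s) - (p * s + q * r) +_) (⁻¹-anti-homo‿- (t * v + u * w) (t * w + u * v)) ⟩
    ((p * r + q * s) - (p * s + q * r)) + ((t * w + u * v) - (t * v + u * w))
      ≡⟨ sub-add _ _ _ _ ⟩
    (p * r + q * s + (t * w + u * v)) - (p * s + q * r + (t * v + u * w)) ∎

  orient-rotate : ∀ A B C → orient B C A ≡ orient A B C
  orient-rotate (a₁ , a₂) (b₁ , b₂) (c₁ , c₂) = begin
    orient (b₁ , b₂) (c₁ , c₂) (a₁ , a₂)
      ≡⟨ expand c₁ b₁ a₂ b₂ c₂ b₂ a₁ b₁ ⟩
    (c₁ * a₂ + b₁ * b₂ + (c₂ * b₁ + b₂ * a₁)) - (c₁ * b₂ + b₁ * a₂ + (c₂ * a₁ + b₂ * b₁))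
      ≡⟨ sub-cong _ _ _ _ (solve 6 (λ a₁ a₂ b₁ b₂ c₁ c₂ →
           (c₁ :* a₂ :+ b₁ :* b₂ :+ (c₂ :* b₁ :+ b₂ :* a₁)) :+ (b₁ :* a₂ :+ a₁ :* c₂ :+ (b₂ :* c₁ :+ a₂ :* a₁))
           := (b₁ :* c₂ :+ a₁ :* a₂ :+ (b₂ :* a₁ :+ a₂ :* c₁)) :+ (c₁ :* b₂ :+ b₁ :* a₂ :+ (c₂ :* a₁ :+ b₂ :* b₁)))
           refl a₁ a₂ b₁ b₂ c₁ c₂) ⟩
    (b₁ * c₂ + a₁ * a₂ + (b₂ * a₁ + a₂ * c₁)) - (b₁ * a₂ + a₁ * c₂ + (b₂ * c₁ + a₂ * a₁))
      ≡⟨ sym (expand b₁ a₁ c₂ a₂ b₂ a₂ c₁ a₁) ⟩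
    orient (a₁ , a₂) (b₁ , b₂) (c₁ , c₂) ∎

  orient-swap : ∀ A B C → orient B A C ≡ - orient A B C
  orient-swap (a₁ , a₂) (b₁ , b₂) (c₁ , c₂) = begin
    orient (b₁ , b₂) (a₁ , a₂) (c₁ , c₂)
      ≡⟨ expand a₁ b₁ c₂ b₂ a₂ b₂ c₁ b₁ ⟩
    (a₁ * c₂ + b₁ * b₂ + (a₂ * b₁ + b₂ * c₁)) - (a₁ * b₂ + b₁ * c₂ + (a₂ * c₁ + b₂ * b₁))
      ≡⟨ sub-cong _ _ _ _ (solve 6 (λ a₁ a₂ b₁ b₂ c₁ c₂ →
           (a₁ :* c₂ :+ b₁ :* b₂ :+ (a₂ :* b₁ :+ b₂ :* c₁)) :+ (b₁ :* c₂ :+ a₁ :* a₂ :+ (b₂ :* a₁ :+ a₂ :* c₁))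
           := (b₁ :* a₂ :+ a₁ :* c₂ :+ (b₂ :* c₁ :+ a₂ :* a₁)) :+ (a₁ :* b₂ :+ b₁ :* c₂ :+ (a₂ :* c₁ :+ b₂ :* b₁)))
           refl a₁ a₂ b₁ b₂ c₁ c₂) ⟩
    (b₁ * a₂ + a₁ * c₂ + (b₂ * c₁ + a₂ * a₁)) - (b₁ * c₂ + a₁ * a₂ + (b₂ * a₁ + a₂ * c₁))
      ≡⟨ sym (⁻¹-anti-homo‿- _ _) ⟩
    - ((b₁ * c₂ + a₁ * a₂ + (b₂ * a₁ + a₂ * c₁)) - (b₁ * a₂ + a₁ * c₂ + (b₂ * c₁ + a₂ * a₁)))
      ≡⟨ cong -_ (sym (expand b₁ a₁ c₂ a₂ b₂ a₂ c₁ a₁)) ⟩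
    - orient (a₁ , a₂) (b₁ , b₂) (c₁ , c₂) ∎

  det : Point → Point → Carrier
  det (u₁ , u₂) (v₁ , v₂) = u₁ * v₂ - u₂ * v₁

  plücker : ∀ a b c d → det a c * det b d ≡ det a b * det c d + det a d * det b c
  plücker (ua , va) (ub , vb) (uc , vc) (ud , vd) = begin
    (ua * vc - va * uc) * (ub * vd - vb * ud)
      ≡⟨ sub-mul _ _ _ _ ⟩
    ((ua * vc) * (ub * vd) + (va * uc) * (vb * ud)) - ((ua * vc) * (vb * ud) + (va * uc) * (ub * vd))
      ≡⟨ sub-cong _ _ _ _ (solve 8 (λ ua va ub vb uc vc ud vd →
           ((ua :* vc) :* (ub :* vd) :+ (va :* uc) :* (vb :* ud))
             :+ (((ua :* vb) :* (vc :* ud) :+ (va :* ub) :* (uc :* vd))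
                 :+ ((ua :* vd) :* (vb :* uc) :+ (va :* ud) :* (ub :* vc)))
           := (((ua :* vb) :* (uc :* vd) :+ (va :* ub) :* (vc :* ud))
                 :+ ((ua :* vd) :* (ub :* vc) :+ (va :* ud) :* (vb :* uc)))
             :+ ((ua :* vc) :* (vb :* ud) :+ (va :* uc) :* (ub :* vd)))
           refl ua va ub vb uc vc ud vd) ⟩
    (((ua * vb) * (uc * vd) + (va * ub) * (vc * ud)) + ((ua * vd) * (ub * vc) + (va * ud) * (vb * uc)))
      - (((ua * vb) * (vc * ud) + (va * ub) * (uc * vd)) + ((ua * vd) * (vb * uc) + (va * ud) * (ub * vc)))
      ≡⟨ sym (sub-add _ _ _ _) ⟩
    (((ua * vb) * (uc * vd) + (va * ub) * (vc * ud)) - ((ua * vb) * (vc * ud) + (va * ub) * (uc * vd)))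
      + (((ua * vd) * (ub * vc) + (va * ud) * (vb * uc)) - ((ua * vd) * (vb * uc) + (va * ud) * (ub * vc)))
      ≡⟨ sym (cong₂ _+_ (sub-mul _ _ _ _) (sub-mul _ _ _ _)) ⟩
    (ua * vb - va * ub) * (uc * vd - vc * ud) + (ua * vd - va * ud) * (ub * vc - vb * uc) ∎

  data SignView (x : Carrier) : Sign → Set where
    positive : 0# < x → SignView x pos
    zero     : x ≡ 0# → SignView x zer
    negative : x < 0# → SignView x neg

  sgn : Carrier → Sign
  sgn x with compare 0# x
  ... | tri< _ _ _ = pos
  ... | tri≈ _ _ _ = zer
  ... | tri> _ _ _ = neg

  signView : ∀ x → SignView x (sgn x)
  signView x with compare 0# x
  ... | tri< 0<x _ _ = positive 0<x
  ... | tri≈ _ 0≡x _ = zero (sym 0≡x)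
  ... | tri> _ _ x<0 = negative x<0

  signView-unique : ∀ {x s t} → SignView x s → SignView x t → s ≡ t
  signView-unique (positive _)   (positive _)   = refl
  signView-unique (zero _)       (zero _)       = refl
  signView-unique (negative _)   (negative _)   = refl
  signView-unique (positive 0<x) (zero x≡0)     = ⊥-elim (irrefl (sym x≡0) 0<x)
  signView-unique (positive 0<x) (negative x<0) = ⊥-elim (asym 0<x x<0)
  signView-unique (zero x≡0)     (positive 0<x) = ⊥-elim (irrefl (sym x≡0) 0<x)
  signView-unique (zero x≡0)     (negative x<0) = ⊥-elim (irrefl x≡0 x<0)
  signView-unique (negative x<0) (positive 0<x) = ⊥-elim (asym 0<x x<0)
  signView-unique (negative x<0) (zero x≡0)     = ⊥-elim (irrefl x≡0 x<0)

  sgn-≡ : ∀ {x s} → SignView x s → sgn x ≡ s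
  sgn-≡ {x} = signView-unique (signView x)

  viewOf : ∀ {x s} → sgn x ≡ s → SignView x s
  viewOf {x} sx≡s = subst (SignView x) sx≡s (signView x)

  sgn-pos⇒pos : ∀ {x} → sgn x ≡ pos → 0# < x
  sgn-pos⇒pos sx≡+ with viewOf sx≡+
  ... | positive 0<x = 0<x

  sgn-neg⇒neg : ∀ {x} → sgn x ≡ neg → x < 0#
  sgn-neg⇒neg sx≡- with viewOf sx≡-
  ... | negative x<0 = x<0

  sgn-zer⇒zero : ∀ {x} → sgn x ≡ zer → x ≡ 0#
  sgn-zer⇒zero sx≡0 with viewOf sx≡0
  ... | zero x≡0 = x≡0

  negate-pos : ∀ {x} → 0# < x → - x < 0#
  negate-pos {x} 0<x = subst₂ _<_ (R.+-identityˡ (- x)) (R.-‿inverseʳ x) (+-monoˡ-< (- x) 0<x)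

  negate-neg : ∀ {x} → x < 0# → 0# < - x
  negate-neg {x} x<0 = subst₂ _<_ (R.-‿inverseʳ x) (R.+-identityˡ (- x)) (+-monoˡ-< (- x) x<0)

  negated-pos : ∀ {x} → 0# < - x → x < 0#
  negated-pos {x} 0<-x = subst₂ _<_ (R.+-identityˡ x) (R.-‿inverseˡ x) (+-monoˡ-< x 0<-x)

  sgn-negate : ∀ x → sgn (- x) ≡ neg ⊗ sgn x
  sgn-negate x with sgn x | signView x
  ... | _ | positive 0<x = sgn-≡ (negative (negate-pos 0<x))
  ... | _ | zero x≡0     = sgn-≡ (zero (trans (cong -_ x≡0) ε⁻¹≈ε))
  ... | _ | negative x<0 = sgn-≡ (positive (negate-neg x<0))

  sgn-* : ∀ x y → sgn (x * y) ≡ sgn x ⊗ sgn y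
  sgn-* x y with sgn x | signView x | sgn y | signView y
  ... | _ | positive 0<x | _ | positive 0<y = sgn-≡ (positive (*-pos 0<x 0<y))
  ... | _ | positive 0<x | _ | negative y<0 =
    sgn-≡ (negative (negated-pos (subst (0# <_) (sym (-‿distribʳ-* x y)) (*-pos 0<x (negate-neg y<0)))))
  ... | _ | negative x<0 | _ | positive 0<y =
    sgn-≡ (negative (negated-pos (subst (0# <_) (sym (-‿distribˡ-* x y)) (*-pos (negate-neg x<0) 0<y))))
  ... | _ | negative x<0 | _ | negative y<0 =
    sgn-≡ (positive (subst (0# <_) (neg-mul x y) (*-pos (negate-neg x<0) (negate-neg y<0))))
  ... | _ | zero x≡0     | _ | _            = sgn-≡ (zero (trans (cong (_* y) x≡0) (R.zeroˡ y)))
  ... | _ | positive _   | _ | zero y≡0     = sgn-≡ (zero (trans (cong (x *_) y≡0) (R.zeroʳ x)))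
  ... | _ | negative _   | _ | zero y≡0     = sgn-≡ (zero (trans (cong (x *_) y≡0) (R.zeroʳ x)))

  sgn-+ : ∀ {x y s} → sgn x ≡ s → sgn y ≡ s → s ≢ zer → sgn (x + y) ≡ s
  sgn-+ {x} {y} {pos} sx sy _ = sgn-≡ (positive (<-trans (sgn-pos⇒pos sy)
    (subst (_< x + y) (R.+-identityˡ y) (+-monoˡ-< y (sgn-pos⇒pos sx)))))
  sgn-+ {x} {y} {neg} sx sy _ = sgn-≡ (negative (<-trans
    (subst (x + y <_) (R.+-identityˡ y) (+-monoˡ-< y (sgn-neg⇒neg sx))) (sgn-neg⇒neg sy)))
  sgn-+ {s = zer} _ _ s≢0 = ⊥-elim (s≢0 refl)

  distinct3? : ∀ {n} (a b c : Fin n) → Dec (Distinct3 a b c)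
  distinct3? a b c = ¬? (a ≟ b) ×-dec ¬? (b ≟ c) ×-dec ¬? (a ≟ c)

  module LineOrder {n : ℕ} (P : Arrangement n) where

    χ : Fin n → Fin n → Fin n → Sign
    χ a b c = sgn (orient (pt P a) (pt P b) (pt P c))

    χ-rotate : ∀ a b c → χ b c a ≡ χ a b c
    χ-rotate a b c = cong sgn (orient-rotate (pt P a) (pt P b) (pt P c))

    χ-swap : ∀ a b c → χ b a c ≡ neg ⊗ χ a b c
    χ-swap a b c = trans (cong sgn (orient-swap (pt P a) (pt P b) (pt P c))) (sgn-negate _)

    χ-swap₂₃ : ∀ a b c → χ a c b ≡ neg ⊗ χ a b c
    χ-swap₂₃ a b c = trans (χ-rotate b a c) (χ-swap a b c)

    χ-≢zer : ∀ {a b c} → Distinct3 a b c → χ a b c ≢ zer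
    χ-≢zer {a} {b} {c} abc χ≡0 = noThreeCollinear P a b c abc (sgn-zer⇒zero χ≡0)

    χ-distinct : ∀ {a b c} → χ a b c ≢ zer → Distinct3 a b c
    χ-distinct {a} {b} {c} χ≢0 = (λ { refl → χ≢0 (χ-repeated a c) })
                               , (λ { refl → χ≢0 (trans (sym (χ-rotate a b b)) (χ-repeated b a)) })
                               , (λ { refl → χ≢0 (trans (χ-rotate a a b) (χ-repeated a b)) })
      where
        χ-repeated : ∀ a c → χ a a c ≡ zer
        χ-repeated a c = self-negative⇒zer (χ-swap a a c)

    χ-degenerate : ∀ {a b c} → ¬ Distinct3 a b c → χ a b c ≡ zer
    χ-degenerate {a} {b} {c} ¬abc with χ a b c ≟ₛ zer
    ... | yes χ≡0 = χ≡0
    ... | no χ≢0 = ⊥-elim (¬abc (χ-distinct χ≢0))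

    -- lineSign i a b c = + says: rotating a line about P i anticlockwise,
    -- starting from line P i P a, line P i P b is met strictly before line P i P c.
    lineSign : Fin n → Fin n → Fin n → Fin n → Sign
    lineSign i a b c = χ i a b ⊗ χ i a c ⊗ χ i b c

    Between : Fin n → Ternary n
    Between i a b c = lineSign i a b c ≡ pos

    lineSign-rotate : ∀ i a b c → lineSign i b c a ≡ lineSign i a b c
    lineSign-rotate i a b c =
      trans (cong₂ (λ u v → χ i b c ⊗ u ⊗ v) (χ-swap₂₃ i a b) (χ-swap₂₃ i a c))
            (⊗-solve 4 (λ n x y z → (z ⊕ (n ⊕ x)) ⊕ (n ⊕ y) ⊜ (n ⊕ n) ⊕ ((x ⊕ y) ⊕ z))
                       refl neg (χ i a b) (χ i a c) (χ i b c))

    lineSign-swap : ∀ i a b c → lineSign i a c b ≡ neg ⊗ lineSign i a b c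
    lineSign-swap i a b c =
      trans (cong (χ i a c ⊗ χ i a b ⊗_) (χ-swap₂₃ i b c))
            (⊗-solve 4 (λ n x y z → (y ⊕ x) ⊕ (n ⊕ z) ⊜ n ⊕ ((x ⊕ y) ⊕ z))
                       refl neg (χ i a b) (χ i a c) (χ i b c))

    lineSign-reverse : ∀ i a b c → lineSign i c b a ≡ neg ⊗ lineSign i a b c
    lineSign-reverse i a b c = trans (lineSign-rotate i a c b) (lineSign-swap i a b c)

    lineSign-≢zer : ∀ {i a b c} → a ≢ i → b ≢ i → c ≢ i → a ≢ b → b ≢ c → a ≢ c →
                    lineSign i a b c ≢ zer
    lineSign-≢zer a≢i b≢i c≢i a≢b b≢c a≢c =
      ⊗-≢zer (⊗-≢zer (χ-≢zer (≢-sym a≢i , a≢b , ≢-sym b≢i)) (χ-≢zer (≢-sym a≢i , a≢c , ≢-sym c≢i)))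
             (χ-≢zer (≢-sym b≢i , b≢c , ≢-sym c≢i))

    between-distinct : ∀ {i a b c} → Between i a b c →
                       (a ≢ i × b ≢ i × c ≢ i) × (a ≢ b × b ≢ c × a ≢ c)
    between-distinct {i} {a} {b} {c} iabc with factors-≢zer (χ i a b) (χ i a c) (χ i b c) iabc
    ... | iab≢0 , iac≢0 , ibc≢0 with χ-distinct iab≢0 | χ-distinct iac≢0 | χ-distinct ibc≢0
    ...   | i≢a , a≢b , _ | _ , a≢c , i≢c | i≢b , b≢c , _ =
      (≢-sym i≢a , ≢-sym i≢b , ≢-sym i≢c) , (a≢b , b≢c , a≢c)

    -- Transitivity via the Plücker relation for the vectors from P i.
    between-trans : ∀ {i a b c d} → Between i a b c → Between i a c d → Between i a b d
    between-trans {i} {a} {b} {c} {d} iabc iacd =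
      line-transitivity-sign {χ i a b} {χ i a c} {χ i a d} {χ i b c} {χ i b d} {χ i c d} iabc iacd
        (begin
          χ i a c ⊗ χ i b d                 ≡⟨ sym (sgn-* _ _) ⟩
          sgn (det (w a) (w c) * det (w b) (w d))
            ≡⟨ cong sgn (plücker (w a) (w b) (w c) (w d)) ⟩
          sgn (det (w a) (w b) * det (w c) (w d) + det (w a) (w d) * det (w b) (w c))
            ≡⟨ sgn-+ (sgn-* _ _) (trans (sgn-* _ _) terms-agree) (⊗-≢zer iab≢0 icd≢0) ⟩
          χ i a b ⊗ χ i c d                 ∎)
      where
        open ≡-Reasoning
        terms-agree : χ i a d ⊗ χ i b c ≡ χ i a b ⊗ χ i c d
        terms-agree = plücker-terms-agree {χ i a b} {χ i a c} {χ i a d} {χ i b c} {χ i c d} iabc iacd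
        iab≢0 : χ i a b ≢ zer
        iab≢0 = proj₁ (factors-≢zer (χ i a b) (χ i a c) (χ i b c) iabc)
        icd≢0 : χ i c d ≢ zer
        icd≢0 = proj₂ (proj₂ (factors-≢zer (χ i a c) (χ i a d) (χ i c d) iacd))
        w : Fin n → Point
        w x = (x-coord (pt P x) - x-coord (pt P i) , y-coord (pt P x) - y-coord (pt P i))

    lineOrder : ∀ i → CyclicOrder i (Between i)
    lineOrder i = record
      { rotate     = λ {a} {b} {c} iabc → trans (lineSign-rotate i a b c) iabc
      ; asym       = λ {a} {b} {c} iabc iacb →
                       pos≢neg (trans (sym iacb) (trans (lineSign-swap i a b c) (cong (neg ⊗_) iabc)))
      ; total      = λ {a} {b} {c} a≢i b≢i c≢i a≢b b≢c a≢c →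
                       positive-or-negative (lineSign-≢zer a≢i b≢i c≢i a≢b b≢c a≢c)
                                            (lineSign-swap i a b c)
      ; transitive = between-trans
      ; distinct   = between-distinct
      }
      where
        pos≢neg : pos ≢ neg
        pos≢neg ()
        positive-or-negative : ∀ {s t} → s ≢ zer → t ≡ neg ⊗ s → s ≡ pos ⊎ t ≡ pos
        positive-or-negative {pos} _ _ = inj₁ refl
        positive-or-negative {neg} _ t≡+ = inj₂ t≡+
        positive-or-negative {zer} s≢0 _ = ⊥-elim (s≢0 refl)

    sgn-metBefore : ∀ i j l k →
      sgn (cross (pt P i) (pt P j) (pt P l) * cross (pt P i) (pt P j) (pt P k)
             * cross (pt P i) (pt P l) (pt P k))
        ≡ lineSign i j l k
    sgn-metBefore i j l k = trans (sgn-* _ _) (cong (_⊗ χ i l k) (sgn-* _ _))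

    lineCycle-successor : ∀ {i σ} → IsLineCycle P i σ → ∀ j → j ≢ i →
                          IsSuccessor (Between i) i j (σ ⟨$⟩ʳ j)
    lineCycle-successor {i} {σ} (_ , next) j j≢i = record
      { ≢centre = proj₁ (next j j≢i) ; loop = loop ; adjacent = adjacent }
      where
        notMet : ∀ l → l ≢ i → ¬ MetBefore P i j l (σ ⟨$⟩ʳ j)
        notMet = proj₂ (next j j≢i)
        loop : σ ⟨$⟩ʳ j ≡ j → ∀ l → l ≢ i → l ≡ j
        loop k≡j l l≢i with l ≟ j
        ... | yes l≡j = l≡j
        ... | no l≢j = ⊥-elim (notMet l l≢i (inj₁ (l≢j , k≡j)))
        adjacent : ∀ l → ¬ Between i j l (σ ⟨$⟩ʳ j)
        adjacent l ijlk with between-distinct ijlk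
        ... | (_ , l≢i , _) , (j≢l , l≢k , j≢k) = notMet l l≢i
          (inj₂ (≢-sym j≢l , ≢-sym j≢k , l≢k , sgn-pos⇒pos (trans (sgn-metBefore i j l _) ijlk)))

  OrientationFactor : ∀ {n} → Arrangement n → Arrangement n → Permutation′ n → Sign → Set
  OrientationFactor P¹ P² δ e =
    ∀ a b c → LineOrder.χ P² (δ ⟨$⟩ʳ a) (δ ⟨$⟩ʳ b) (δ ⟨$⟩ʳ c) ≡ e ⊗ LineOrder.χ P¹ a b c

  QuadrupleFactor : ∀ {n} → Arrangement n → Arrangement n → Permutation′ n → Sign → Set
  QuadrupleFactor {n} P¹ P² δ e = ∀ {i j l k : Fin n} → j ≢ i → l ≢ i → k ≢ i → j ≢ l → l ≢ k → j ≢ k →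
    LineOrder.lineSign P² (δ ⟨$⟩ʳ i) (δ ⟨$⟩ʳ j) (δ ⟨$⟩ʳ l) (δ ⟨$⟩ʳ k)
      ≡ e ⊗ LineOrder.lineSign P¹ i j l k

  positive-⇔ : ∀ {x} → (0# < x) ⇔ (sgn x ≡ pos)
  positive-⇔ = mk⇔ (λ 0<x → sgn-≡ (positive 0<x)) sgn-pos⇒pos

  negative-⇔ : ∀ {x} → (x < 0#) ⇔ (sgn x ≡ neg)
  negative-⇔ = mk⇔ (λ x<0 → sgn-≡ (negative x<0)) sgn-neg⇒neg

  module Orientations {n : ℕ} (P¹ P² : Arrangement n) (δ : Permutation′ n) where
    module L¹ = LineOrder P¹
    module L² = LineOrder P²

    o¹ o² : Fin n → Fin n → Fin n → Carrier
    o¹ a b c = orient (pt P¹ a) (pt P¹ b) (pt P¹ c)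
    o² a b c = orient (pt P² (δ ⟨$⟩ʳ a)) (pt P² (δ ⟨$⟩ʳ b)) (pt P² (δ ⟨$⟩ʳ c))

    distinct-image : ∀ {a b c} → Distinct3 a b c → Distinct3 (δ ⟨$⟩ʳ a) (δ ⟨$⟩ʳ b) (δ ⟨$⟩ʳ c)
    distinct-image (a≢b , b≢c , a≢c) = ⟨$⟩ʳ-≢ δ a≢b , ⟨$⟩ʳ-≢ δ b≢c , ⟨$⟩ʳ-≢ δ a≢c

    distinct-preimage : ∀ {a b c} → Distinct3 (δ ⟨$⟩ʳ a) (δ ⟨$⟩ʳ b) (δ ⟨$⟩ʳ c) → Distinct3 a b c
    distinct-preimage (a≢b , b≢c , a≢c) =
      (λ e → a≢b (cong (δ ⟨$⟩ʳ_) e)) , (λ e → b≢c (cong (δ ⟨$⟩ʳ_) e)) , (λ e → a≢c (cong (δ ⟨$⟩ʳ_) e))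

    degenerate-factor : ∀ e {a b c} → ¬ Distinct3 a b c →
                        L².χ (δ ⟨$⟩ʳ a) (δ ⟨$⟩ʳ b) (δ ⟨$⟩ʳ c) ≡ e ⊗ L¹.χ a b c
    degenerate-factor e ¬abc = trans (L².χ-degenerate (λ abc → ¬abc (distinct-preimage abc)))
                                     (sym (trans (cong (e ⊗_) (L¹.χ-degenerate ¬abc)) (⊗-comm e zer)))

    preserving⇒factor : OrientationPreserving P¹ P² δ → OrientationFactor P¹ P² δ pos
    preserving⇒factor pres a b c with distinct3? a b c
    ... | no ¬abc = degenerate-factor pos ¬abc
    ... | yes abc = sym (≡-byPositivity (L¹.χ-≢zer abc) (L².χ-≢zer (distinct-image abc))
                          (λ χ¹≡+ → sgn-≡ (positive (Equivalence.to (pres a b c abc) (sgn-pos⇒pos χ¹≡+))))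
                          (λ χ²≡+ → sgn-≡ (positive (Equivalence.from (pres a b c abc) (sgn-pos⇒pos χ²≡+)))))

    reversing⇒factor : OrientationReversing P¹ P² δ → OrientationFactor P¹ P² δ neg
    reversing⇒factor rev a b c with distinct3? a b c
    ... | no ¬abc = degenerate-factor neg ¬abc
    ... | yes abc = ≡-neg-byPositivity (L¹.χ-≢zer abc) (L².χ-≢zer (distinct-image abc))
                      (λ χ¹≡+ → sgn-≡ (negative (Equivalence.to (rev a b c abc) (sgn-pos⇒pos χ¹≡+))))
                      (λ χ²≡- → sgn-≡ (positive (Equivalence.from (rev a b c abc) (sgn-neg⇒neg χ²≡-))))

    sgn-transfer : ∀ {e} → e ≢ zer → OrientationFactor P¹ P² δ e → ∀ s a b c →
                   (sgn (o¹ a b c) ≡ s) ⇔ (sgn (o² a b c) ≡ e ⊗ s)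
    sgn-transfer {e} e≢0 f s a b c = mk⇔ (λ χ¹≡s → trans (f a b c) (cong (e ⊗_) χ¹≡s))
                                         (λ χ²≡es → ⊗-cancelˡ e≢0 (trans (sym (f a b c)) χ²≡es))

    strict-transfer : ∀ {e} → e ≢ zer → OrientationFactor P¹ P² δ e → ∀ s {A B : Carrier → Set} →
                      (∀ {x} → A x ⇔ (sgn x ≡ s)) → (∀ {x} → B x ⇔ (sgn x ≡ e ⊗ s)) →
                      ∀ a b c → A (o¹ a b c) ⇔ B (o² a b c)
    strict-transfer e≢0 f s A⇔ B⇔ a b c = ⇔.trans A⇔ (⇔.trans (sgn-transfer e≢0 f s a b c) (⇔.sym B⇔))

    -- Conversely, factor pos/neg makes δ an orientation preserving/reversing
    -- isomorphism: "D inside ABC" is a condition on strict orientation signs.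
    factor⇒preserving : OrientationFactor P¹ P² δ pos →
                        IsIsomorphism P¹ P² δ × OrientationPreserving P¹ P² δ
    factor⇒preserving f = (λ a b c d → (keep-pos a b d ×-⇔ keep-pos b c d ×-⇔ keep-pos c a d)
                                    ⊎-⇔ (keep-neg a b d ×-⇔ keep-neg b c d ×-⇔ keep-neg c a d))
                        , (λ a b c _ → keep-pos a b c)
      where
        keep-pos : ∀ a b c → (0# < o¹ a b c) ⇔ (0# < o² a b c)
        keep-pos = strict-transfer pos≢zer f pos positive-⇔ positive-⇔
        keep-neg : ∀ a b c → (o¹ a b c < 0#) ⇔ (o² a b c < 0#)
        keep-neg = strict-transfer pos≢zer f neg negative-⇔ negative-⇔

    factor⇒reversing : OrientationFactor P¹ P² δ neg →
                       IsIsomorphism P¹ P² δ × OrientationReversing P¹ P² δ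
    factor⇒reversing f = (λ a b c d → ⇔.trans ((flip-pos a b d ×-⇔ flip-pos b c d ×-⇔ flip-pos c a d)
                                             ⊎-⇔ (flip-neg a b d ×-⇔ flip-neg b c d ×-⇔ flip-neg c a d))
                                             (mk⇔ swap swap))
                       , (λ a b c _ → flip-pos a b c)
      where
        flip-pos : ∀ a b c → (0# < o¹ a b c) ⇔ (o² a b c < 0#)
        flip-pos = strict-transfer neg≢zer f pos positive-⇔ negative-⇔
        flip-neg : ∀ a b c → (o¹ a b c < 0#) ⇔ (0# < o² a b c)
        flip-neg = strict-transfer neg≢zer f neg negative-⇔ positive-⇔

    factor-cong : ∀ π {e} → (∀ i → δ ⟨$⟩ʳ i ≡ π ⟨$⟩ʳ i) →
                  OrientationFactor P¹ P² π e → OrientationFactor P¹ P² δ e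
    factor-cong π δ≗π f a b c rewrite δ≗π a | δ≗π b | δ≗π c = f a b c

    factor⇒isomorphism : Σ Sign (λ e → e ≢ zer × OrientationFactor P¹ P² δ e) →
                         (IsIsomorphism P¹ P² δ × OrientationPreserving P¹ P² δ)
                           ⊎ (IsIsomorphism P¹ P² δ × OrientationReversing P¹ P² δ)
    factor⇒isomorphism (pos , _ , f) = inj₁ (factor⇒preserving f)
    factor⇒isomorphism (neg , _ , f) = inj₂ (factor⇒reversing f)
    factor⇒isomorphism (zer , e≢0 , _) = ⊥-elim (e≢0 refl)

  module LineCycles {n : ℕ} (P¹ P² : Arrangement n) (σ¹ σ² : Fin n → Permutation′ n)
    (cycle¹ : ∀ i → IsLineCycle P¹ i (σ¹ i)) (cycle² : ∀ i → IsLineCycle P² i (σ² i))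
    (δ : Permutation′ n) where
    open Orientations P¹ P² δ
    open ≡-Reasoning

    successor¹ : ∀ i j → j ≢ i → IsSuccessor (L¹.Between i) i j (σ¹ i ⟨$⟩ʳ j)
    successor¹ i = L¹.lineCycle-successor {i} {σ¹ i} (cycle¹ i)

    successor² : ∀ i j → j ≢ i → IsSuccessor (L².Between i) i j (σ² i ⟨$⟩ʳ j)
    successor² i = L².lineCycle-successor {i} {σ² i} (cycle² i)

    -- Line signs transform by the same factor as orientations, since every
    -- index occurs in three orientation signs and e ⊗ e ⊗ e = e.
    lineSign-factor : ∀ {e} → OrientationFactor P¹ P² δ e → ∀ i j l k →
      L².lineSign (δ ⟨$⟩ʳ i) (δ ⟨$⟩ʳ j) (δ ⟨$⟩ʳ l) (δ ⟨$⟩ʳ k) ≡ e ⊗ L¹.lineSign i j l k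
    lineSign-factor {e} f i j l k = begin
      L².lineSign (δ ⟨$⟩ʳ i) (δ ⟨$⟩ʳ j) (δ ⟨$⟩ʳ l) (δ ⟨$⟩ʳ k)
        ≡⟨ cong₂ _⊗_ (cong₂ _⊗_ (f i j l) (f i j k)) (f i l k) ⟩
      e ⊗ x ⊗ (e ⊗ y) ⊗ (e ⊗ z)
        ≡⟨ ⊗-solve 4 (λ e x y z → ((e ⊕ x) ⊕ (e ⊕ y)) ⊕ (e ⊕ z) ⊜ ((e ⊕ e) ⊕ e) ⊕ ((x ⊕ y) ⊕ z))
                   refl e x y z ⟩
      e ⊗ e ⊗ e ⊗ (x ⊗ y ⊗ z)
        ≡⟨ cong (_⊗ (x ⊗ y ⊗ z)) (⊗-cube e) ⟩
      e ⊗ (x ⊗ y ⊗ z) ∎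
      where
        x y z : Sign
        x = L¹.χ i j l
        y = L¹.χ i j k
        z = L¹.χ i l k

    conjugates : OrientationFactor P¹ P² δ pos →
                 ∀ i k → σ² (δ ⟨$⟩ʳ i) ⟨$⟩ʳ k ≡ δ ⟨$⟩ʳ (σ¹ i ⟨$⟩ʳ (δ ⟨$⟩ˡ k))
    conjugates f i k = trans (cong (σ² (δ ⟨$⟩ʳ i) ⟨$⟩ʳ_) (sym (inverseʳ δ))) (on-image (δ ⟨$⟩ˡ k))
      where
        reflect : ∀ {a b c} → L².Between (δ ⟨$⟩ʳ i) (δ ⟨$⟩ʳ a) (δ ⟨$⟩ʳ b) (δ ⟨$⟩ʳ c) → L¹.Between i a b c
        reflect {a} {b} {c} between = trans (sym (lineSign-factor f i a b c)) between
        on-image : ∀ j → σ² (δ ⟨$⟩ʳ i) ⟨$⟩ʳ (δ ⟨$⟩ʳ j) ≡ δ ⟨$⟩ʳ (σ¹ i ⟨$⟩ʳ j)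
        on-image j with j ≟ i
        ... | yes refl = trans (proj₁ (cycle² (δ ⟨$⟩ʳ i))) (cong (δ ⟨$⟩ʳ_) (sym (proj₁ (cycle¹ i))))
        ... | no j≢i = CyclicOrderProperties.successor-unique (L².lineOrder (δ ⟨$⟩ʳ i)) (⟨$⟩ʳ-≢ δ j≢i)
                         (successor² (δ ⟨$⟩ʳ i) (δ ⟨$⟩ʳ j) (⟨$⟩ʳ-≢ δ j≢i))
                         (successor-image δ reflect (successor¹ i j j≢i))

    inverse-conjugates : OrientationFactor P¹ P² δ neg →
                         ∀ i k → σ² (δ ⟨$⟩ʳ i) ⟨$⟩ˡ k ≡ δ ⟨$⟩ʳ (σ¹ i ⟨$⟩ʳ (δ ⟨$⟩ˡ k))
    inverse-conjugates f i k = begin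
      σ² (δ ⟨$⟩ʳ i) ⟨$⟩ˡ k
        ≡⟨ cong (σ² (δ ⟨$⟩ʳ i) ⟨$⟩ˡ_) (trans (sym (inverseʳ δ)) (sym (on-image (δ ⟨$⟩ˡ k)))) ⟩
      σ² (δ ⟨$⟩ʳ i) ⟨$⟩ˡ (σ² (δ ⟨$⟩ʳ i) ⟨$⟩ʳ (δ ⟨$⟩ʳ (σ¹ i ⟨$⟩ʳ (δ ⟨$⟩ˡ k))))
        ≡⟨ inverseˡ (σ² (δ ⟨$⟩ʳ i)) ⟩
      δ ⟨$⟩ʳ (σ¹ i ⟨$⟩ʳ (δ ⟨$⟩ˡ k)) ∎
      where
        reflect : ∀ {a b c} → L².Between (δ ⟨$⟩ʳ i) (δ ⟨$⟩ʳ c) (δ ⟨$⟩ʳ b) (δ ⟨$⟩ʳ a) → L¹.Between i a b c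
        reflect {a} {b} {c} between = begin
          L¹.lineSign i a b c                  ≡⟨ ⊗-assoc neg neg _ ⟩
          neg ⊗ (neg ⊗ L¹.lineSign i a b c)    ≡⟨ cong (neg ⊗_) (sym (L¹.lineSign-reverse i a b c)) ⟩
          neg ⊗ L¹.lineSign i c b a            ≡⟨ sym (lineSign-factor f i c b a) ⟩
          L².lineSign (δ ⟨$⟩ʳ i) (δ ⟨$⟩ʳ c) (δ ⟨$⟩ʳ b) (δ ⟨$⟩ʳ a)
                                               ≡⟨ between ⟩
          pos                                  ∎
        on-image : ∀ j → σ² (δ ⟨$⟩ʳ i) ⟨$⟩ʳ (δ ⟨$⟩ʳ (σ¹ i ⟨$⟩ʳ j)) ≡ δ ⟨$⟩ʳ j
        on-image j with j ≟ i
        ... | yes refl = trans (cong (λ z → σ² (δ ⟨$⟩ʳ i) ⟨$⟩ʳ (δ ⟨$⟩ʳ z)) (proj₁ (cycle¹ i)))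
                               (proj₁ (cycle² (δ ⟨$⟩ʳ i)))
        ... | no j≢i = CyclicOrderProperties.successor-unique (L².lineOrder (δ ⟨$⟩ʳ i)) (⟨$⟩ʳ-≢ δ m≢i)
                         (successor² (δ ⟨$⟩ʳ i) (δ ⟨$⟩ʳ m) (⟨$⟩ʳ-≢ δ m≢i))
                         (successor-reverse (⟨$⟩ʳ-≢ δ j≢i) (successor-image δ reflect (successor¹ i j j≢i)))
          where
            m : Fin n
            m = σ¹ i ⟨$⟩ʳ j
            m≢i : m ≢ i
            m≢i = IsSuccessor.≢centre (successor¹ i j j≢i)

    lineSign²-≢zer : ∀ {i a b c} → a ≢ i → b ≢ i → c ≢ i → a ≢ b → b ≢ c → a ≢ c →
                     L².lineSign (δ ⟨$⟩ʳ i) (δ ⟨$⟩ʳ a) (δ ⟨$⟩ʳ b) (δ ⟨$⟩ʳ c) ≢ zer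
    lineSign²-≢zer a≢i b≢i c≢i a≢b b≢c a≢c =
      L².lineSign-≢zer (⟨$⟩ʳ-≢ δ a≢i) (⟨$⟩ʳ-≢ δ b≢i) (⟨$⟩ʳ-≢ δ c≢i) (⟨$⟩ʳ-≢ δ a≢b) (⟨$⟩ʳ-≢ δ b≢c) (⟨$⟩ʳ-≢ δ a≢c)

    Pulled : Fin n → Ternary n
    Pulled i a b c = L².Between (δ ⟨$⟩ʳ i) (δ ⟨$⟩ʳ a) (δ ⟨$⟩ʳ b) (δ ⟨$⟩ʳ c)

    pulledOrder : ∀ i → CyclicOrder i (Pulled i)
    pulledOrder i = pullback δ (L².lineOrder (δ ⟨$⟩ʳ i))

    agreeing-signs : ∀ {s t : Fin n → Fin n → Fin n → Fin n → Sign} →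
      (∀ i → CyclicOrder i (λ a b c → s i a b c ≡ pos)) → (∀ i → CyclicOrder i (λ a b c → t i a b c ≡ pos)) →
      (∀ i j → j ≢ i → IsSuccessor (λ a b c → s i a b c ≡ pos) i j (σ¹ i ⟨$⟩ʳ j)) →
      (∀ i j → j ≢ i → IsSuccessor (λ a b c → t i a b c ≡ pos) i j (σ¹ i ⟨$⟩ʳ j)) →
      ∀ {i j l k} → s i j l k ≢ zer → t i j l k ≢ zer → s i j l k ≡ t i j l k
    agreeing-signs Os Ot succ-s succ-t {i} s≢0 t≢0 =
      ≡-byPositivity s≢0 t≢0
        (successor-determines (Os i) (Ot i) (σ¹ i ⟨$⟩ʳ_) (succ-s i) (succ-t i))
        (successor-determines (Ot i) (Os i) (σ¹ i ⟨$⟩ʳ_) (succ-t i) (succ-s i))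

    -- Conversely, if δ conjugates the line cycles, then the line order at
    -- P² (δ i) pulled back along δ has successor function σ¹ i, so it agrees
    -- with the line order at P¹ i.
    conjugates⇒quadrupleFactor : (∀ i k → σ² (δ ⟨$⟩ʳ i) ⟨$⟩ʳ k ≡ δ ⟨$⟩ʳ (σ¹ i ⟨$⟩ʳ (δ ⟨$⟩ˡ k))) →
                                 QuadrupleFactor P¹ P² δ pos
    conjugates⇒quadrupleFactor conj j≢i l≢i k≢i j≢l l≢k j≢k =
      agreeing-signs {s = λ i a b c → L².lineSign (δ ⟨$⟩ʳ i) (δ ⟨$⟩ʳ a) (δ ⟨$⟩ʳ b) (δ ⟨$⟩ʳ c)}
                     {t = L¹.lineSign}
        pulledOrder L¹.lineOrder succ-pulled successor¹
        (lineSign²-≢zer j≢i l≢i k≢i j≢l l≢k j≢k)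
        (L¹.lineSign-≢zer j≢i l≢i k≢i j≢l l≢k j≢k)
      where
        succ-pulled : ∀ i j → j ≢ i → IsSuccessor (Pulled i) i j (σ¹ i ⟨$⟩ʳ j)
        succ-pulled i j j≢i = successor-preimage δ
          (subst (IsSuccessor (L².Between (δ ⟨$⟩ʳ i)) (δ ⟨$⟩ʳ i) (δ ⟨$⟩ʳ j))
                 (trans (conj i (δ ⟨$⟩ʳ j)) (cong (λ z → δ ⟨$⟩ʳ (σ¹ i ⟨$⟩ʳ z)) (inverseˡ δ)))
                 (successor² (δ ⟨$⟩ʳ i) (δ ⟨$⟩ʳ j) (⟨$⟩ʳ-≢ δ j≢i)))

    -- If δ carries σ¹ to the inverses of σ², the reversed pulled-back order has
    -- successor function σ¹ i, and δ reverses all line signs.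
    inverse-conjugates⇒quadrupleFactor :
      (∀ i k → σ² (δ ⟨$⟩ʳ i) ⟨$⟩ˡ k ≡ δ ⟨$⟩ʳ (σ¹ i ⟨$⟩ʳ (δ ⟨$⟩ˡ k))) → QuadrupleFactor P¹ P² δ neg
    inverse-conjugates⇒quadrupleFactor inv {i} {j} {l} {k} j≢i l≢i k≢i j≢l l≢k j≢k = begin
      L².lineSign (δ ⟨$⟩ʳ i) (δ ⟨$⟩ʳ j) (δ ⟨$⟩ʳ l) (δ ⟨$⟩ʳ k)
        ≡⟨ L².lineSign-reverse (δ ⟨$⟩ʳ i) (δ ⟨$⟩ʳ k) (δ ⟨$⟩ʳ l) (δ ⟨$⟩ʳ j) ⟩
      neg ⊗ L².lineSign (δ ⟨$⟩ʳ i) (δ ⟨$⟩ʳ k) (δ ⟨$⟩ʳ l) (δ ⟨$⟩ʳ j)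
        ≡⟨ cong (neg ⊗_) (agreeing-signs
             {s = λ i a b c → L².lineSign (δ ⟨$⟩ʳ i) (δ ⟨$⟩ʳ c) (δ ⟨$⟩ʳ b) (δ ⟨$⟩ʳ a)} {t = L¹.lineSign}
             (λ i → reverse (pulledOrder i)) L¹.lineOrder succ-reversed successor¹
             (lineSign²-≢zer k≢i l≢i j≢i (≢-sym l≢k) (≢-sym j≢l) (≢-sym j≢k))
             (L¹.lineSign-≢zer j≢i l≢i k≢i j≢l l≢k j≢k)) ⟩
      neg ⊗ L¹.lineSign i j l k ∎
      where
        succ-reversed : ∀ i j → j ≢ i → IsSuccessor (λ a b c → Pulled i c b a) i j (σ¹ i ⟨$⟩ʳ j)
        succ-reversed i j j≢i = successor-reverse m≢i (successor-preimage δ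
          (subst (IsSuccessor (L².Between (δ ⟨$⟩ʳ i)) (δ ⟨$⟩ʳ i) (δ ⟨$⟩ʳ m)) σ²m≡j
                 (successor² (δ ⟨$⟩ʳ i) (δ ⟨$⟩ʳ m) (⟨$⟩ʳ-≢ δ m≢i))))
          where
            m : Fin n
            m = σ¹ i ⟨$⟩ʳ j
            m≢i : m ≢ i
            m≢i = IsSuccessor.≢centre (successor¹ i j j≢i)
            σ²m≡j : σ² (δ ⟨$⟩ʳ i) ⟨$⟩ʳ (δ ⟨$⟩ʳ m) ≡ δ ⟨$⟩ʳ j
            σ²m≡j = begin
              σ² (δ ⟨$⟩ʳ i) ⟨$⟩ʳ (δ ⟨$⟩ʳ m)
                ≡⟨ cong (λ z → σ² (δ ⟨$⟩ʳ i) ⟨$⟩ʳ (δ ⟨$⟩ʳ (σ¹ i ⟨$⟩ʳ z))) (sym (inverseˡ δ)) ⟩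
              σ² (δ ⟨$⟩ʳ i) ⟨$⟩ʳ (δ ⟨$⟩ʳ (σ¹ i ⟨$⟩ʳ (δ ⟨$⟩ˡ (δ ⟨$⟩ʳ j))))
                ≡⟨ cong (σ² (δ ⟨$⟩ʳ i) ⟨$⟩ʳ_) (sym (inv i (δ ⟨$⟩ʳ j))) ⟩
              σ² (δ ⟨$⟩ʳ i) ⟨$⟩ʳ (σ² (δ ⟨$⟩ʳ i) ⟨$⟩ˡ (δ ⟨$⟩ʳ j))
                ≡⟨ inverseʳ (σ² (δ ⟨$⟩ʳ i)) ⟩
              δ ⟨$⟩ʳ j ∎

  -- The "discrepancy"
  -- D a b c = χ² (δ a) (δ b) (δ c) ⊗ χ¹ a b c is symmetric, any three
  -- discrepancies sharing a point multiply to e, and hence D is constant on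
  -- distinct triples.
  module UniformFactor {n : ℕ} (P¹ P² : Arrangement n) (δ : Permutation′ n)
    {e : Sign} (e≢0 : e ≢ zer) (quad : QuadrupleFactor P¹ P² δ e) where
    open Orientations P¹ P² δ
    open ≡-Reasoning

    D : Fin n → Fin n → Fin n → Sign
    D a b c = L².χ (δ ⟨$⟩ʳ a) (δ ⟨$⟩ʳ b) (δ ⟨$⟩ʳ c) ⊗ L¹.χ a b c

    negate-both : ∀ x y → (neg ⊗ x) ⊗ (neg ⊗ y) ≡ x ⊗ y
    negate-both = ⊗-solve 3 (λ n x y → (n ⊕ x) ⊕ (n ⊕ y) ⊜ (n ⊕ n) ⊕ (x ⊕ y)) refl neg

    D-swap : ∀ a b c → D b a c ≡ D a b c
    D-swap a b c = trans (cong₂ _⊗_ (L².χ-swap (δ ⟨$⟩ʳ a) (δ ⟨$⟩ʳ b) (δ ⟨$⟩ʳ c)) (L¹.χ-swap a b c))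
                          (negate-both (L².χ (δ ⟨$⟩ʳ a) (δ ⟨$⟩ʳ b) (δ ⟨$⟩ʳ c)) (L¹.χ a b c))

    D-swap₂₃ : ∀ a b c → D a c b ≡ D a b c
    D-swap₂₃ a b c =
      trans (cong₂ _⊗_ (L².χ-swap₂₃ (δ ⟨$⟩ʳ a) (δ ⟨$⟩ʳ b) (δ ⟨$⟩ʳ c)) (L¹.χ-swap₂₃ a b c))
            (negate-both (L².χ (δ ⟨$⟩ʳ a) (δ ⟨$⟩ʳ b) (δ ⟨$⟩ʳ c)) (L¹.χ a b c))

    D-rotate : ∀ a b c → D b c a ≡ D a b c
    D-rotate a b c = cong₂ _⊗_ (L².χ-rotate (δ ⟨$⟩ʳ a) (δ ⟨$⟩ʳ b) (δ ⟨$⟩ʳ c)) (L¹.χ-rotate a b c)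

    D-triple : ∀ {i j l k} → j ≢ i → l ≢ i → k ≢ i → j ≢ l → l ≢ k → j ≢ k →
               D i j l ⊗ D i j k ⊗ D i l k ≡ e
    D-triple {i} {j} {l} {k} j≢i l≢i k≢i j≢l l≢k j≢k = begin
      D i j l ⊗ D i j k ⊗ D i l k
        ≡⟨ ⊗-solve 6 (λ t₁ s₁ t₂ s₂ t₃ s₃ → ((t₁ ⊕ s₁) ⊕ (t₂ ⊕ s₂)) ⊕ (t₃ ⊕ s₃)
                                         ⊜ ((t₁ ⊕ t₂) ⊕ t₃) ⊕ ((s₁ ⊕ s₂) ⊕ s₃))
                   refl (L².χ (δ ⟨$⟩ʳ i) (δ ⟨$⟩ʳ j) (δ ⟨$⟩ʳ l)) (L¹.χ i j l)
                        (L².χ (δ ⟨$⟩ʳ i) (δ ⟨$⟩ʳ j) (δ ⟨$⟩ʳ k)) (L¹.χ i j k)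
                        (L².χ (δ ⟨$⟩ʳ i) (δ ⟨$⟩ʳ l) (δ ⟨$⟩ʳ k)) (L¹.χ i l k) ⟩
      L².lineSign (δ ⟨$⟩ʳ i) (δ ⟨$⟩ʳ j) (δ ⟨$⟩ʳ l) (δ ⟨$⟩ʳ k) ⊗ L¹.lineSign i j l k
        ≡⟨ cong (_⊗ L¹.lineSign i j l k) (quad j≢i l≢i k≢i j≢l l≢k j≢k) ⟩
      e ⊗ L¹.lineSign i j l k ⊗ L¹.lineSign i j l k
        ≡⟨ ⊗-involutiveʳ e (L¹.lineSign-≢zer j≢i l≢i k≢i j≢l l≢k j≢k) ⟩
      e ∎

    D-exchange : ∀ {a b c d} → a ≢ b → a ≢ c → a ≢ d → b ≢ c → b ≢ d → c ≢ d → D a c d ≡ D b c d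
    D-exchange {a} {b} {c} {d} a≢b a≢c a≢d b≢c b≢d c≢d = ⊗-cancelˡ common≢0 (begin
      D a b c ⊗ D a b d ⊗ D a c d   ≡⟨ D-triple (≢-sym a≢b) (≢-sym a≢c) (≢-sym a≢d) b≢c c≢d b≢d ⟩
      e                             ≡⟨ sym (D-triple a≢b (≢-sym b≢c) (≢-sym b≢d) a≢c c≢d a≢d) ⟩
      D b a c ⊗ D b a d ⊗ D b c d   ≡⟨ cong₂ (λ u v → u ⊗ v ⊗ D b c d) (D-swap a b c) (D-swap a b d) ⟩
      D a b c ⊗ D a b d ⊗ D b c d   ∎)
      where
        common≢0 : D a b c ⊗ D a b d ≢ zer
        common≢0 = ⊗-≢zerˡ {D a b c ⊗ D a b d} {D a c d} λ abcd≡0 →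
          e≢0 (trans (sym (D-triple (≢-sym a≢b) (≢-sym a≢c) (≢-sym a≢d) b≢c c≢d b≢d)) abcd≡0)

    -- Hence any distinct triple can be transformed into any other, one point
    -- at a time, without changing D.
    replace-third : ∀ {a b c z} → Distinct3 a b c → z ≢ a → z ≢ b → D a b c ≡ D a b z
    replace-third {a} {b} {c} {z} (a≢b , b≢c , a≢c) z≢a z≢b with z ≟ c
    ... | yes refl = refl
    ... | no z≢c = begin
      D a b c   ≡⟨ D-rotate c a b ⟩
      D c a b   ≡⟨ D-exchange (≢-sym z≢c) (≢-sym a≢c) (≢-sym b≢c) z≢a z≢b a≢b ⟩
      D z a b   ≡⟨ sym (D-rotate z a b) ⟩
      D a b z   ∎

    bring-first : ∀ {a b c} x → Distinct3 a b c →
                  Σ (Fin n) λ p → Σ (Fin n) λ q → Distinct3 x p q × D a b c ≡ D x p q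
    bring-first {a} {b} {c} x (a≢b , b≢c , a≢c) with x ≟ a | x ≟ b | x ≟ c
    ... | yes refl | _ | _ = b , c , (a≢b , b≢c , a≢c) , refl
    ... | no _ | yes refl | _ = a , c , (≢-sym a≢b , a≢c , b≢c) , sym (D-swap a b c)
    ... | no _ | no _ | yes refl = a , b , (≢-sym a≢c , a≢b , ≢-sym b≢c) , D-rotate c a b
    ... | no x≢a | no x≢b | no _ = a , b , (x≢a , a≢b , x≢b) ,
                                   trans (replace-third (a≢b , b≢c , a≢c) x≢a x≢b) (D-rotate x a b)

    bring-second : ∀ {x p q} y → Distinct3 x p q → y ≢ x →
                   Σ (Fin n) λ r → Distinct3 x y r × D x p q ≡ D x y r
    bring-second {x} {p} {q} y (x≢p , p≢q , x≢q) y≢x with y ≟ p | y ≟ q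
    ... | yes refl | _ = q , (x≢p , p≢q , x≢q) , refl
    ... | no _ | yes refl = p , (x≢q , ≢-sym p≢q , x≢p) , sym (D-swap₂₃ x p q)
    ... | no y≢p | no y≢q = p , (≢-sym y≢x , y≢p , x≢p) ,
                            trans (replace-third (x≢p , p≢q , x≢q) y≢x y≢p) (D-swap₂₃ x y p)

    D-constant : ∀ {a b c x y z} → Distinct3 a b c → Distinct3 x y z → D a b c ≡ D x y z
    D-constant {x = x} {y} {z} abc (x≢y , y≢z , x≢z) =
      let (p , q , xpq , abc≡xpq) = bring-first x abc
          (r , xyr , xpq≡xyr) = bring-second y xpq (≢-sym x≢y)
      in trans abc≡xpq (trans xpq≡xyr (replace-third xyr (≢-sym x≢z) (≢-sym y≢z)))

    -- The factor is the common value of D; with fewer than three points every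
    -- triple is degenerate and any factor works.
    uniformFactor : Σ Sign λ e′ → e′ ≢ zer × OrientationFactor P¹ P² δ e′
    uniformFactor with any? (λ a → any? (λ b → any? (λ c → distinct3? a b c)))
    ... | yes (a₀ , b₀ , c₀ , abc₀) =
      D a₀ b₀ c₀ , ⊗-≢zer (L².χ-≢zer (distinct-image abc₀)) (L¹.χ-≢zer abc₀) , factor
      where
        factor : OrientationFactor P¹ P² δ (D a₀ b₀ c₀)
        factor a b c with distinct3? a b c
        ... | yes abc = trans (sym (⊗-involutiveʳ _ (L¹.χ-≢zer abc)))
                              (cong (_⊗ L¹.χ a b c) (D-constant abc abc₀))
        ... | no ¬abc = degenerate-factor (D a₀ b₀ c₀) ¬abc
    ... | no no-triple =
      pos , pos≢zer , λ a b c → degenerate-factor pos λ abc → no-triple (a , b , c , abc)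

mainTheorem3 : (F : OrderedField) → let open Geometry F in
    (n : ℕ) (P¹ P² : Arrangement n)
    (σ¹ σ² : Fin n → Permutation′ n) →
    (∀ i → IsLineCycle P¹ i (σ¹ i)) →
    (∀ i → IsLineCycle P² i (σ² i)) →
    (δ : Permutation′ n) →
    ((IsIsomorphism P¹ P² δ × OrientationPreserving P¹ P² δ)
       ⊎ (IsIsomorphism P¹ P² δ × OrientationReversing P¹ P² δ))
    ⇔ Σ (Permutation′ n) (λ π →
        (∀ i → δ ⟨$⟩ʳ i ≡ π ⟨$⟩ʳ i) ×
        ((∀ i k → σ² (π ⟨$⟩ʳ i) ⟨$⟩ʳ k ≡ π ⟨$⟩ʳ (σ¹ i ⟨$⟩ʳ (π ⟨$⟩ˡ k)))
          ⊎ (∀ i k → σ² (π ⟨$⟩ʳ i) ⟨$⟩ˡ k ≡ π ⟨$⟩ʳ (σ¹ i ⟨$⟩ʳ (π ⟨$⟩ˡ k)))))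
mainTheorem3 F n P¹ P² σ¹ σ² cycle¹ cycle² δ = mk⇔
  -- δ itself is the permutation: it scales all orientations by ±, hence all
  -- line orders, and so (inversely) conjugates the line cycles.
  (λ { (inj₁ (_ , preserving)) →
         δ , (λ _ → refl) , inj₁ (LC.conjugates δ (O.preserving⇒factor preserving))
     ; (inj₂ (_ , reversing)) →
         δ , (λ _ → refl) , inj₂ (LC.inverse-conjugates δ (O.reversing⇒factor reversing)) })
  -- Conjugation makes the line orders agree up to a sign, which forces a
  -- uniform orientation factor.
  (λ { (π , δ≗π , inj₁ conj) →
         isomorphism π δ≗π (uniformFactor P¹ P² π pos≢zer (LC.conjugates⇒quadrupleFactor π conj))
     ; (π , δ≗π , inj₂ inv) →
         isomorphism π δ≗π (uniformFactor P¹ P² π neg≢zer (LC.inverse-conjugates⇒quadrupleFactor π inv)) })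
  where
    open Geometry F
    open PlaneGeometry F
    open UniformFactor using (uniformFactor)
    module O = Orientations P¹ P² δ
    module LC = LineCycles P¹ P² σ¹ σ² cycle¹ cycle²
    isomorphism : ∀ π → (∀ i → δ ⟨$⟩ʳ i ≡ π ⟨$⟩ʳ i) →
                  Σ Sign (λ e → e ≢ zer × OrientationFactor P¹ P² π e) →
                  (IsIsomorphism P¹ P² δ × OrientationPreserving P¹ P² δ)
                    ⊎ (IsIsomorphism P¹ P² δ × OrientationReversing P¹ P² δ)
    isomorphism π δ≗π (e , e≢0 , f) = O.factor⇒isomorphism (e , e≢0 , O.factor-cong π δ≗π f)
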